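{- Let $w\in S_n$, let $\mathbf{i}=(i_1,\dots,i_\ell)$ be a reduced word of $w$ (so $w=s_{i_1}\cdots s_{i_\ell}$ with $\ell$ minimal), and fix $k$. Let $a_1<\cdots<a_N$ be the positions $a$ with $i_a=k$, set $w^{(0)}=\mathrm{id}$, $w^{(j)}=s_{i_1}s_{i_2}\cdots s_{i_{a_j}}$ for $1\le j\le N$, $A_j=\{w^{(j)}(1),\dots,w^{(j)}(k)\}$, and $P_k(\mathbf{i})=(A_0,A_1,\dots,A_N)$. Then $P_k(\mathbf{i})$ is a monotone weakly separated path. Conversely, for any monotone weakly separated path $P$ of $k$-subsets of $[n]$ whose first set is $\{1,2,\dots,k\}$, there exists a reduced word $\mathbf{i}$ (of some permutation in $S_n$) such that $P_k(\mathbf{i})=P$.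
   Context: $s_k=(k\ k{+}1)$. Two different $k$-subsets $I,J\subseteq[n]$ are weakly separated if $\max(I\setminus J)<\min(J\setminus I)$ or $\max(J\setminus I)<\min(I\setminus J)$; a collection of $k$-subsets is weakly separated if every pair of different sets in it is weakly separated. A sequence $(A_0,A_1,\dots,A_N)$ of $k$-subsets is a monotone weakly separated path if the collection $\{A_0,\dots,A_N\}$ is weakly separated and for each $i=1,\dots,N$, $A_i\setminus A_{i-1}=\{x_i\}$ and $A_{i-1}\setminus A_i=\{y_i\}$ are singletons with $x_i>y_i$. -}

module Defs where

open import Data.Bool using (Bool; true; false; if_then_else_)
open import Data.Nat using (ℕ; zero; suc; _≤_; _<_; _≡ᵇ_; _<ᵇ_; _∸_)
open import Data.Fin using (Fin; toℕ)
import Data.Fin as F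
open import Data.Fin.Subset using (Subset; _─_; ⁅_⁆; ∣_∣)
import Data.Fin.Subset as S
open import Data.List using (List; []; _∷_; map; upTo; length)
open import Data.Bool.ListAction using (any)
open import Data.List.Relation.Unary.All using (All)
open import Data.List.Relation.Unary.Linked using (Linked)
import Data.List.Membership.Propositional as LM
open import Data.Vec using (tabulate)
open import Data.Product using (Σ; ∃; ∃₂; _×_)
open import Data.Sum using (_⊎_)
open import Relation.Binary.PropositionalEquality using (_≡_; _≢_)

-- Permutations and words.  Elements of [n] are the naturals 1..n.
-- A word is a list of letters i (the simple transposition s_i = (i i+1)).

sₜ : ℕ → ℕ → ℕ
sₜ i x = if x ≡ᵇ i then suc i else (if x ≡ᵇ suc i then i else x)

act : List ℕ → ℕ → ℕ
act []       x = x
act (i ∷ is) x = sₜ i (act is x)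

WordOf : ℕ → List ℕ → Set
WordOf n w = All (λ i → 1 ≤ i × i ≤ n ∸ 1) w

Reduced : ℕ → List ℕ → Set
Reduced n w = WordOf n w ×
  (∀ (v : List ℕ) → WordOf n v → (∀ x → act v x ≡ act w x) → length w ≤ length v)

-- {u(1),…,u(k)} as a subset of [n]; Fin index x stands for element x+1.
imageSet : (n k : ℕ) → List ℕ → Subset n
imageSet n k u = tabulate λ (x : Fin n) →
  any (λ m → act u (suc m) ≡ᵇ suc (toℕ x)) (upTo k)

firstK : (n k : ℕ) → Subset n
firstK n k = tabulate λ (x : Fin n) → toℕ x <ᵇ k

prefixesEndingIn : ℕ → List ℕ → List (List ℕ)
prefixesEndingIn k []       = []
prefixesEndingIn k (i ∷ is) =
  let rest = map (i ∷_) (prefixesEndingIn k is) in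
  if i ≡ᵇ k then (i ∷ []) ∷ rest else rest

Pk : (n k : ℕ) → List ℕ → List (Subset n)
Pk n k w = imageSet n k [] ∷ map (imageSet n k) (prefixesEndingIn k w)

Below : ∀ {n} → Subset n → Subset n → Set
Below I J = ∀ x y → x S.∈ (I ─ J) → y S.∈ (J ─ I) → x F.< y

WeaklySeparated : ∀ {n} → Subset n → Subset n → Set
WeaklySeparated I J = Below I J ⊎ Below J I

WSCollection : ∀ {n} → List (Subset n) → Set
WSCollection P = ∀ {I J} → I LM.∈ P → J LM.∈ P → I ≢ J → WeaklySeparated I J

MonotoneStep : ∀ {n} → Subset n → Subset n → Set
MonotoneStep A B = ∃₂ λ x y → (B ─ A ≡ ⁅ x ⁆) × (A ─ B ≡ ⁅ y ⁆) × y F.< x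

MonotoneWSPath : (n k : ℕ) → List (Subset n) → Set
MonotoneWSPath n k P =
  All (λ A → ∣ A ∣ ≡ k) P × WSCollection P × Linked MonotoneStep P

-- A word is reduced exactly when each of its letters is an ascent of the prefix before it:
-- counting inversions shows that such words are reduced, and a descent could be cancelled
-- against the letter that created it.  Along an ascending word an inversion between a
-- position ≤ k and a position > k is never undone, which makes the sets w(1..k) of its
-- prefixes pairwise weakly separated; a letter s_k exchanges w(k) for the larger w(k+1),
-- and every other letter leaves the set unchanged.
--
-- Conversely, a step A → B of the path that removes y = w(a) and adds x = w(b) > y is
-- realised by appending the block s_a⋯s_{k-1} s_{b-1}⋯s_{k+1} s_k.  It is ascending thanks
-- to an invariant: every inversion of w between two positions on the same side of k is
-- separated by a set met earlier on the path (one containing the larger value but not the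
-- smaller), and weak separation of that set from B forbids the inversions the block would
-- have to undo.

module Submission where

open import Defs
open import Algebra.Properties.CommutativeSemigroup using (x∙yz≈y∙xz)
open import Data.Bool using (Bool; true; false; T; if_then_else_)
open import Data.Bool.ListAction using (any)
open import Data.Bool.Properties using (T-≡)
open import Data.Empty using (⊥; ⊥-elim)
open import Data.Fin as F using (Fin; toℕ; fromℕ<) renaming (zero to fzero; suc to fsuc)
open import Data.Fin.Properties using (toℕ-fromℕ<; toℕ-injective; toℕ<n)
  renaming (<-trans to <-transᶠ; <-asym to <-asymᶠ; <-irrefl to <-irreflᶠ)
open import Data.Fin.Subset using (Subset; _─_; _∪_; ∣_∣; _∈_; _∉_; _⊆_; ⁅_⁆)
open import Data.Fin.Subset.Properties
  using (⊆-antisym; drop-there; p─q⊆p; x∈⁅x⁆; x∈⁅y⁆⇒x≡y; x∈p∧x∉q⇒x∈p─q; _∈?_; x∈p∪q⁺; x∈p∪q⁻; ∪-identityʳ)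
open import Data.List using (List; []; _∷_; _++_; reverse; [_]; upTo; applyUpTo; length; map)
open import Data.List.Membership.Propositional using () renaming (_∈_ to _∈ₗ_)
open import Data.List.Membership.Propositional.Properties using (∈-map⁻; ∈-++⁺ʳ)
open import Data.List.Properties
  using (unfold-reverse; reverse-involutive; map-id; map-++; map-∘; ++-identityʳ; ++-assoc; length-++-sucʳ)
open import Data.List.Relation.Unary.All using (All; []; _∷_)
import Data.List.Relation.Unary.All as All
open import Data.List.Relation.Unary.All.Properties using (++⁺; ++⁻ˡ; ++⁻ʳ)
open import Data.List.Relation.Unary.Any using (here; there)
open import Data.List.Relation.Unary.Any.Properties using (any⁻; any⁺; applyUpTo⁻; applyUpTo⁺)
open import Data.List.Relation.Unary.Linked using (Linked; [-]; _∷_)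
open import Data.Nat
open import Data.Nat.Properties
open import Data.Product using (Σ; ∃; ∃₂; _×_; _,_; proj₁; proj₂)
open import Data.Sum using (_⊎_; inj₁; inj₂)
open import Data.Unit using (⊤; tt)
open import Data.Vec using ([]; _∷_; tabulate)
open import Data.Vec.Base using (here; there)
open import Data.Vec.Properties using ([]=⇒lookup; lookup⇒[]=; lookup∘tabulate)
open import Function using (_∘_; Equivalence)
open import Function.Definitions using (Injective)
open import Relation.Binary using (tri<; tri≈; tri>)
open import Relation.Binary.PropositionalEquality hiding ([_])
open import Relation.Nullary using (¬_; yes; no; does; contradiction)
open import Relation.Nullary.Decidable using (dec-true; dec-false; _×-dec_)

-- Simple transpositions acting on ℕ

Injective≡ : (ℕ → ℕ) → Set
Injective≡ = Injective _≡_ _≡_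

≡⇒≡ᵇ≡true : ∀ {m n} → m ≡ n → (m ≡ᵇ n) ≡ true
≡⇒≡ᵇ≡true {m} {n} m≡n = Equivalence.to T-≡ (≡⇒≡ᵇ m n m≡n)

≢⇒≡ᵇ≡false : ∀ {m n} → m ≢ n → (m ≡ᵇ n) ≡ false
≢⇒≡ᵇ≡false {m} {n} m≢n with m ≡ᵇ n in eq
... | false = refl
... | true  = contradiction (≡ᵇ⇒≡ m n (Equivalence.from T-≡ eq)) m≢n

sₜ-i≡1+i : ∀ i → sₜ i i ≡ suc i
sₜ-i≡1+i i rewrite ≡⇒≡ᵇ≡true (refl {x = i}) = refl

sₜ-1+i≡i : ∀ i → sₜ i (suc i) ≡ i
sₜ-1+i≡i i rewrite ≢⇒≡ᵇ≡false {suc i} {i} 1+n≢n | ≡⇒≡ᵇ≡true (refl {x = i}) = refl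

sₜ-fix : ∀ {i x} → x ≢ i → x ≢ suc i → sₜ i x ≡ x
sₜ-fix x≢i x≢1+i rewrite ≢⇒≡ᵇ≡false x≢i | ≢⇒≡ᵇ≡false x≢1+i = refl

data Sₜ-Case (i x : ℕ) : Set where
  at-i   : x ≡ i → Sₜ-Case i x
  at-1+i : x ≡ suc i → Sₜ-Case i x
  apart  : x ≢ i → x ≢ suc i → Sₜ-Case i x

sₜ-case : ∀ i x → Sₜ-Case i x
sₜ-case i x with x ≟ i | x ≟ suc i
... | yes x≡i | _          = at-i x≡i
... | no _    | yes x≡1+i  = at-1+i x≡1+i
... | no x≢i  | no x≢1+i   = apart x≢i x≢1+i

sₜ-involutive : ∀ i x → sₜ i (sₜ i x) ≡ x
sₜ-involutive i x with sₜ-case i x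
... | at-i refl   rewrite sₜ-i≡1+i i = sₜ-1+i≡i i
... | at-1+i refl rewrite sₜ-1+i≡i i = sₜ-i≡1+i i
... | apart p q   rewrite sₜ-fix p q = sₜ-fix p q

sₜ-injective : ∀ i → Injective≡ (sₜ i)
sₜ-injective i {x} {y} eq =
  trans (sym (sₜ-involutive i x)) (trans (cong (sₜ i) eq) (sₜ-involutive i y))

sₜ-fix-below : ∀ {k c} → c < k → sₜ k c ≡ c
sₜ-fix-below c<k = sₜ-fix (<⇒≢ c<k) (<⇒≢ (m<n⇒m<1+n c<k))

sₜ≡i⇒≡1+i : ∀ {i c} → sₜ i c ≡ i → c ≡ suc i
sₜ≡i⇒≡1+i {i} {c} eq = sₜ-injective i (trans eq (sym (sₜ-1+i≡i i)))

sₜ-fix-above : ∀ {k c} → suc k < c → sₜ k c ≡ c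
sₜ-fix-above {k} k+1<c = sₜ-fix (<⇒≢ (<-trans (n<1+n k) k+1<c) ∘ sym) (<⇒≢ k+1<c ∘ sym)

sₜ-<-mono : ∀ {i c d} → c < d → ¬ (c ≡ i × d ≡ suc i) → sₜ i c < sₜ i d
sₜ-<-mono {i} {c} {d} c<d ¬swap with sₜ-case i c | sₜ-case i d
... | at-i refl   | at-i refl   = contradiction c<d (<-irrefl refl)
... | at-i refl   | at-1+i refl = contradiction (refl , refl) ¬swap
... | at-i refl   | apart p q   rewrite sₜ-i≡1+i i | sₜ-fix p q = ≤∧≢⇒< c<d (q ∘ sym)
... | at-1+i refl | at-i refl   = contradiction (n<1+n i) (<-asym c<d)
... | at-1+i refl | at-1+i refl = contradiction c<d (<-irrefl refl)
... | at-1+i refl | apart p q   rewrite sₜ-1+i≡i i | sₜ-fix p q = <-trans (n<1+n i) c<d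
... | apart p q   | at-i refl   rewrite sₜ-i≡1+i i | sₜ-fix p q = <-trans c<d (n<1+n i)
... | apart p q   | at-1+i refl rewrite sₜ-1+i≡i i | sₜ-fix p q = ≤∧≢⇒< (≤-pred c<d) p
... | apart p q   | apart p′ q′ rewrite sₜ-fix p q | sₜ-fix p′ q′ = c<d

act-++ : ∀ u v x → act (u ++ v) x ≡ act u (act v x)
act-++ []      v x = refl
act-++ (i ∷ u) v x = cong (sₜ i) (act-++ u v x)

act-injective : ∀ u → Injective≡ (act u)
act-injective []      eq = eq
act-injective (i ∷ u) eq = act-injective u (sₜ-injective i eq)

act-act-reverse : ∀ u x → act u (act (reverse u) x) ≡ x
act-act-reverse []      x = refl
act-act-reverse (i ∷ u) x = begin
  sₜ i (act u (act (reverse (i ∷ u)) x))     ≡⟨ cong (λ v → sₜ i (act u (act v x))) (unfold-reverse i u) ⟩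
  sₜ i (act u (act (reverse u ++ [ i ]) x))  ≡⟨ cong (sₜ i ∘ act u) (act-++ (reverse u) [ i ] x) ⟩
  sₜ i (act u (act (reverse u) (sₜ i x)))    ≡⟨ cong (sₜ i) (act-act-reverse u (sₜ i x)) ⟩
  sₜ i (sₜ i x)                              ≡⟨ sₜ-involutive i x ⟩
  x                                          ∎
  where open ≡-Reasoning

act-reverse-≡ : ∀ u {x y} → act u x ≡ y → act (reverse u) y ≡ x
act-reverse-≡ u {x} refl =
  trans (cong (λ v → act (reverse u) (act v x)) (sym (reverse-involutive u))) (act-act-reverse (reverse u) x)

InRange : ℕ → ℕ → Set
InRange n x = 1 ≤ x × x ≤ n

Letter : ℕ → ℕ → Set
Letter n i = 1 ≤ i × i ≤ n ∸ 1

letter⇒1+i≤n : ∀ {n i} → Letter n i → suc i ≤ n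
letter⇒1+i≤n {suc n} (_ , i≤n) = s≤s i≤n
letter⇒1+i≤n {zero}  (1≤i , i≤0) = contradiction (≤-trans 1≤i i≤0) λ ()

<⇒letter : ∀ {n i} → 1 ≤ i → i < n → Letter n i
<⇒letter {suc n} 1≤i (s≤s i≤n) = 1≤i , i≤n

sₜ-range : ∀ {n i x} → Letter n i → InRange n x → InRange n (sₜ i x)
sₜ-range {n} {i} {x} i∈ (1≤x , x≤n) with sₜ-case i x
... | at-i refl   rewrite sₜ-i≡1+i i = s≤s z≤n , letter⇒1+i≤n i∈
... | at-1+i refl rewrite sₜ-1+i≡i i = let (1≤i , _) = i∈ in 1≤i , ≤-trans (n≤1+n i) x≤n
... | apart p q   rewrite sₜ-fix p q = 1≤x , x≤n

act-range : ∀ {n u x} → WordOf n u → InRange n x → InRange n (act u x)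
act-range []       x∈ = x∈
act-range (i ∷ is) x∈ = sₜ-range i (act-range is x∈)

All-reverse : ∀ {P : ℕ → Set} {u} → All P u → All P (reverse u)
All-reverse {u = []}    []       = []
All-reverse {P} {i ∷ u} (p ∷ ps) rewrite unfold-reverse i u = ++⁺ (All-reverse ps) (_∷_ {P = P} p [])

All-delete : ∀ {P : ℕ → Set} xs {y ys} → All P (xs ++ y ∷ ys) → All P (xs ++ ys)
All-delete []       (_ ∷ pys)  = pys
All-delete (x ∷ xs) (px ∷ pxs) = px ∷ All-delete xs pxs

-- The sets {g(1), …, g(k)}

-- imageSet n k u unfolds to image n k (act u).
image : (n k : ℕ) → (ℕ → ℕ) → Subset n
image n k g = tabulate λ (x : Fin n) → any (λ m → g (suc m) ≡ᵇ suc (toℕ x)) (upTo k)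

Attains : ℕ → (ℕ → ℕ) → ℕ → Set
Attains k g v = Σ ℕ λ c → 1 ≤ c × c ≤ k × g c ≡ v

∈-tabulate⁻ : ∀ {n} {f : Fin n → Bool} {z} → z ∈ tabulate f → T (f z)
∈-tabulate⁻ {f = f} {z} z∈ =
  Equivalence.from T-≡ (trans (sym (lookup∘tabulate f z)) ([]=⇒lookup z∈))

∈-tabulate⁺ : ∀ {n} {f : Fin n → Bool} {z} → T (f z) → z ∈ tabulate f
∈-tabulate⁺ {f = f} {z} fz =
  lookup⇒[]= z (tabulate f) (trans (lookup∘tabulate f z) (Equivalence.to T-≡ fz))

∈-image⁻ : ∀ {n} k g {z : Fin n} → z ∈ image n k g → Attains k g (suc (toℕ z))
∈-image⁻ k g {z} z∈ with applyUpTo⁻ _ (any⁻ _ (upTo k) (∈-tabulate⁻ z∈))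
... | m , m<k , hit = suc m , s≤s z≤n , m<k , ≡ᵇ⇒≡ (g (suc m)) _ hit

∈-image⁺ : ∀ {n k} g {z : Fin n} → Attains k g (suc (toℕ z)) → z ∈ image n k g
∈-image⁺ g {z} (suc m , _ , m<k , gc≡z) =
  ∈-tabulate⁺ (any⁺ _ (applyUpTo⁺ _ (≡⇒≡ᵇ (g (suc m)) _ gc≡z) m<k))

image-ext : ∀ {n} k g h → (∀ {v} → Attains k g v → Attains k h v) →
            (∀ {v} → Attains k h v → Attains k g v) → image n k g ≡ image n k h
image-ext k g h g⇒h h⇒g = ⊆-antisym (∈-image⁺ h ∘ g⇒h ∘ ∈-image⁻ k g) (∈-image⁺ g ∘ h⇒g ∘ ∈-image⁻ k h)

x∈p─q⇒x∉q : ∀ {n} {p q : Subset n} {x} → x ∈ p ─ q → x ∉ q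
x∈p─q⇒x∉q {p = true  ∷ p} {false ∷ q} here          = λ ()
x∈p─q⇒x∉q {p = true  ∷ p} {true  ∷ q} {fzero} ()
x∈p─q⇒x∉q {p = false ∷ p} {true  ∷ q} {fzero} ()
x∈p─q⇒x∉q {p = false ∷ p} {false ∷ q} {fzero} ()
x∈p─q⇒x∉q {p = _     ∷ p} {_     ∷ q} (there x∈p─q) = x∈p─q⇒x∉q x∈p─q ∘ drop-there

∣p∪⁅x⁆∣≡1+∣p∣ : ∀ {n} {p : Subset n} {x} → x ∉ p → ∣ p ∪ ⁅ x ⁆ ∣ ≡ suc ∣ p ∣
∣p∪⁅x⁆∣≡1+∣p∣ {p = true  ∷ p} {fzero}  x∉p = contradiction here x∉p
∣p∪⁅x⁆∣≡1+∣p∣ {p = false ∷ p} {fzero}  _   = cong (suc ∘ ∣_∣) (∪-identityʳ p)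
∣p∪⁅x⁆∣≡1+∣p∣ {p = true  ∷ p} {fsuc x} x∉p = cong suc (∣p∪⁅x⁆∣≡1+∣p∣ (x∉p ∘ there))
∣p∪⁅x⁆∣≡1+∣p∣ {p = false ∷ p} {fsuc x} x∉p = ∣p∪⁅x⁆∣≡1+∣p∣ (x∉p ∘ there)

toFin : ∀ {n v} → InRange n v → Fin n
toFin {v = suc v} (_ , v<n) = fromℕ< v<n

suc-toℕ-toFin : ∀ {n v} (r : InRange n v) → suc (toℕ (toFin r)) ≡ v
suc-toℕ-toFin {v = suc v} (_ , v<n) = cong suc (toℕ-fromℕ< v<n)

suc-toℕ-injective : ∀ {n} {z z′ : Fin n} → suc (toℕ z) ≡ suc (toℕ z′) → z ≡ z′
suc-toℕ-injective = toℕ-injective ∘ suc-injective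

∣tabulate-false∣≡0 : ∀ n → ∣ tabulate {n = n} (λ _ → false) ∣ ≡ 0
∣tabulate-false∣≡0 zero    = refl
∣tabulate-false∣≡0 (suc n) = ∣tabulate-false∣≡0 n

image-suc : ∀ {n k} g (r : InRange n (g (suc k))) → image n (suc k) g ≡ image n k g ∪ ⁅ toFin r ⁆
image-suc {n} {k} g r = ⊆-antisym to from
  where
  to : image n (suc k) g ⊆ image n k g ∪ ⁅ toFin r ⁆
  to z∈ with ∈-image⁻ (suc k) g z∈
  ... | c , 1≤c , c≤1+k , gc≡z with m≤n⇒m<n∨m≡n c≤1+k
  ...   | inj₁ c<1+k = x∈p∪q⁺ (inj₁ (∈-image⁺ g (c , 1≤c , ≤-pred c<1+k , gc≡z)))
  ...   | inj₂ refl  = x∈p∪q⁺ (inj₂ (subst (_∈ ⁅ toFin r ⁆) (suc-toℕ-injective (trans (suc-toℕ-toFin r) gc≡z))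
                                          (x∈⁅x⁆ (toFin r))))
  from : image n k g ∪ ⁅ toFin r ⁆ ⊆ image n (suc k) g
  from z∈ with x∈p∪q⁻ _ _ z∈
  ... | inj₁ z∈old with ∈-image⁻ k g z∈old
  ...   | c , 1≤c , c≤k , gc≡z = ∈-image⁺ g (c , 1≤c , m≤n⇒m≤1+n c≤k , gc≡z)
  from z∈ | inj₂ z∈⁅x⁆ rewrite x∈⁅y⁆⇒x≡y _ z∈⁅x⁆ = ∈-image⁺ g (suc k , s≤s z≤n , ≤-refl , sym (suc-toℕ-toFin r))

∣image∣≡k : ∀ {n k g} → Injective≡ g → (∀ {c} → 1 ≤ c → c ≤ k → InRange n (g c)) →
            ∣ image n k g ∣ ≡ k
∣image∣≡k {n} {zero}  _     _       = ∣tabulate-false∣≡0 n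
∣image∣≡k {n} {suc k} {g} g-inj g-range = begin
  ∣ image n (suc k) g ∣            ≡⟨ cong ∣_∣ (image-suc g r) ⟩
  ∣ image n k g ∪ ⁅ toFin r ⁆ ∣    ≡⟨ ∣p∪⁅x⁆∣≡1+∣p∣ new ⟩
  suc ∣ image n k g ∣              ≡⟨ cong suc (∣image∣≡k g-inj (λ 1≤c c≤k → g-range 1≤c (m≤n⇒m≤1+n c≤k))) ⟩
  suc k                            ∎
  where
  open ≡-Reasoning
  r = g-range (s≤s z≤n) ≤-refl
  new : toFin r ∉ image n k g
  new x∈ with ∈-image⁻ k g x∈
  ... | c , _ , c≤k , gc≡x = 1+n≰n (subst (_≤ k) (g-inj (trans gc≡x (suc-toℕ-toFin r))) c≤k)

image-id≡firstK : ∀ n k → image n k (λ x → x) ≡ firstK n k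
image-id≡firstK n k = ⊆-antisym
  (λ z∈ → let (_ , _ , z<k , eq) = ∈-image⁻ k (λ x → x) z∈ in
           ∈-tabulate⁺ (<⇒<ᵇ (subst (_≤ k) eq z<k)))
  (λ z∈ → ∈-image⁺ (λ x → x) (_ , s≤s z≤n , <ᵇ⇒< _ k (∈-tabulate⁻ z∈) , refl))

sₜ-preserves-[1,k] : ∀ {i k c} → 1 ≤ i → i ≢ k → 1 ≤ c → c ≤ k → 1 ≤ sₜ i c × sₜ i c ≤ k
sₜ-preserves-[1,k] {i} {k} {c} 1≤i i≢k 1≤c c≤k with sₜ-case i c
... | at-i refl   rewrite sₜ-i≡1+i i = s≤s z≤n , ≤∧≢⇒< c≤k i≢k
... | at-1+i refl rewrite sₜ-1+i≡i i = 1≤i , ≤-trans (n≤1+n i) c≤k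
... | apart p q   rewrite sₜ-fix p q = 1≤c , c≤k

image-∘sₜ : ∀ {n k i} g → 1 ≤ i → i ≢ k → image n k (g ∘ sₜ i) ≡ image n k g
image-∘sₜ {k = k} {i} g 1≤i i≢k = image-ext k (g ∘ sₜ i) g
  (λ (c , 1≤c , c≤k , eq) → let (1≤c′ , c′≤k) = sₜ-preserves-[1,k] 1≤i i≢k 1≤c c≤k in
     sₜ i c , 1≤c′ , c′≤k , eq)
  (λ (c , 1≤c , c≤k , eq) → let (1≤c′ , c′≤k) = sₜ-preserves-[1,k] 1≤i i≢k 1≤c c≤k in
     sₜ i c , 1≤c′ , c′≤k , trans (cong g (sₜ-involutive i c)) eq)

image-cong : ∀ {n} k {g h} → (∀ x → g x ≡ h x) → image n k g ≡ image n k h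
image-cong k {g} {h} g≗h = image-ext k g h
  (λ (c , 1≤c , c≤k , eq) → c , 1≤c , c≤k , trans (sym (g≗h c)) eq)
  (λ (c , 1≤c , c≤k , eq) → c , 1≤c , c≤k , trans (g≗h c) eq)

∉-image⇒k< : ∀ {n k} h {z : Fin n} {c} → 1 ≤ c → z ∉ image n k h → h c ≡ suc (toℕ z) → k < c
∉-image⇒k< {k = k} h {c = c} 1≤c z∉ hc≡z with k <? c
... | yes k<c = k<c
... | no  k≮c = contradiction (∈-image⁺ h (c , 1≤c , ≮⇒≥ k≮c , hc≡z)) z∉

∣image-act∣≡k : ∀ {n k u} → k ≤ n → WordOf n u → ∣ image n k (act u) ∣ ≡ k
∣image-act∣≡k {u = u} k≤n word =
  ∣image∣≡k (act-injective u) (λ 1≤c c≤k → act-range word (1≤c , ≤-trans c≤k k≤n))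

-- Reduced words are the ascending words

Ascending : (ℕ → ℕ) → List ℕ → Set
Ascending g []       = ⊤
Ascending g (i ∷ is) = g i < g (suc i) × Ascending (g ∘ sₜ i) is

Ascending-++⁺ : ∀ g u {v} → Ascending g u → Ascending (g ∘ act u) v → Ascending g (u ++ v)
Ascending-++⁺ g []      _              asc-v = asc-v
Ascending-++⁺ g (i ∷ u) (asc-i , asc-u) asc-v = asc-i , Ascending-++⁺ (g ∘ sₜ i) u asc-u asc-v

Ascending-++⁻ : ∀ g u {v} → Ascending g (u ++ v) → Ascending g u × Ascending (g ∘ act u) v
Ascending-++⁻ g []      asc             = tt , asc
Ascending-++⁻ g (i ∷ u) (asc-i , asc-uv) =
  let (asc-u , asc-v) = Ascending-++⁻ (g ∘ sₜ i) u asc-uv in (asc-i , asc-u) , asc-v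

Ascending-cong : ∀ {g h} w → (∀ x → g x ≡ h x) → Ascending g w → Ascending h w
Ascending-cong []      _   _               = tt
Ascending-cong (i ∷ w) g≗h (asc-i , asc-w) =
  subst₂ _<_ (g≗h i) (g≗h (suc i)) asc-i , Ascending-cong w (g≗h ∘ sₜ i) asc-w

countBelow : ℕ → List ℕ → ℕ
countBelow x []       = 0
countBelow x (y ∷ ys) = if does (y <? x) then suc (countBelow x ys) else countBelow x ys

inversions : List ℕ → ℕ
inversions []       = 0
inversions (x ∷ xs) = countBelow x xs + inversions xs

swapAt : ℕ → List ℕ → List ℕ
swapAt zero    (x ∷ y ∷ xs) = y ∷ x ∷ xs
swapAt zero    xs           = xs
swapAt (suc i) []           = []
swapAt (suc i) (x ∷ xs)     = x ∷ swapAt i xs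

AscentAt : ℕ → List ℕ → Set
AscentAt zero    (x ∷ y ∷ _) = x < y
AscentAt (suc i) (_ ∷ xs)    = AscentAt i xs
AscentAt _       _           = ⊥

countBelow-swapAt : ∀ x i xs → countBelow x (swapAt i xs) ≡ countBelow x xs
countBelow-swapAt x zero    []           = refl
countBelow-swapAt x zero    (a ∷ [])     = refl
countBelow-swapAt x zero    (a ∷ b ∷ xs) with does (a <? x) | does (b <? x)
... | true  | true  = refl
... | true  | false = refl
... | false | true  = refl
... | false | false = refl
countBelow-swapAt x (suc i) []           = refl
countBelow-swapAt x (suc i) (a ∷ xs)     with does (a <? x)
... | true  = cong suc (countBelow-swapAt x i xs)
... | false = countBelow-swapAt x i xs

countBelow-∷-≤ : ∀ x y xs → countBelow x (y ∷ xs) ≤ suc (countBelow x xs)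
countBelow-∷-≤ x y xs with does (y <? x)
... | true  = ≤-refl
... | false = n≤1+n _

countBelow-≤-∷ : ∀ x y xs → countBelow x xs ≤ countBelow x (y ∷ xs)
countBelow-≤-∷ x y xs with does (y <? x)
... | true  = n≤1+n _
... | false = ≤-refl

inversions-swapAt-≤ : ∀ i xs → inversions (swapAt i xs) ≤ suc (inversions xs)
inversions-swapAt-≤ zero    []           = n≤1+n _
inversions-swapAt-≤ zero    (x ∷ [])     = n≤1+n _
inversions-swapAt-≤ zero    (x ∷ y ∷ xs) = begin
  countBelow y (x ∷ xs) + (countBelow x xs + inversions xs)
    ≤⟨ +-monoˡ-≤ _ (countBelow-∷-≤ y x xs) ⟩
  suc (countBelow y xs + (countBelow x xs + inversions xs))
    ≡⟨ cong suc (x∙yz≈y∙xz +-commutativeSemigroup (countBelow y xs) (countBelow x xs) (inversions xs)) ⟩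
  suc (countBelow x xs + (countBelow y xs + inversions xs))
    ≤⟨ s≤s (+-monoˡ-≤ _ (countBelow-≤-∷ x y xs)) ⟩
  suc (countBelow x (y ∷ xs) + (countBelow y xs + inversions xs)) ∎
  where open ≤-Reasoning
inversions-swapAt-≤ (suc i) []       = n≤1+n _
inversions-swapAt-≤ (suc i) (x ∷ xs) rewrite countBelow-swapAt x i xs =
  ≤-trans (+-monoʳ-≤ _ (inversions-swapAt-≤ i xs)) (≤-reflexive (+-suc _ _))

inversions-swapAt : ∀ i xs → AscentAt i xs → inversions (swapAt i xs) ≡ suc (inversions xs)
inversions-swapAt zero    (x ∷ y ∷ xs) x<y
  rewrite dec-true (x <? y) x<y | dec-false (y <? x) (<⇒≯ x<y) =
  cong suc (x∙yz≈y∙xz +-commutativeSemigroup (countBelow y xs) (countBelow x xs) (inversions xs))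
inversions-swapAt (suc i) (x ∷ xs) asc rewrite countBelow-swapAt x i xs | inversions-swapAt i xs asc =
  +-suc _ _

applyUpTo-cong : ∀ {f g : ℕ → ℕ} m → (∀ x → f x ≡ g x) → applyUpTo f m ≡ applyUpTo g m
applyUpTo-cong zero    f≗g = refl
applyUpTo-cong (suc m) f≗g = cong₂ _∷_ (f≗g 0) (applyUpTo-cong m (f≗g ∘ suc))

sₜ-suc : ∀ i x → sₜ (suc i) (suc x) ≡ suc (sₜ i x)
sₜ-suc i x with x ≡ᵇ i | x ≡ᵇ suc i
... | true  | _     = refl
... | false | true  = refl
... | false | false = refl

applyUpTo-∘sₜ : ∀ f {i m} → suc i < m → applyUpTo (f ∘ sₜ i) m ≡ swapAt i (applyUpTo f m)
applyUpTo-∘sₜ f {zero}  {suc (suc m)} _ = refl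
applyUpTo-∘sₜ f {zero}  {suc zero}    (s≤s ())
applyUpTo-∘sₜ f {suc i} {suc m}       (s≤s i<m) = cong (f 0 ∷_) (begin
  applyUpTo (f ∘ sₜ (suc i) ∘ suc) m  ≡⟨ applyUpTo-cong m (cong f ∘ sₜ-suc i) ⟩
  applyUpTo (f ∘ suc ∘ sₜ i) m        ≡⟨ applyUpTo-∘sₜ (f ∘ suc) i<m ⟩
  swapAt i (applyUpTo (f ∘ suc) m)    ∎)
  where open ≡-Reasoning

applyUpTo-ascentAt : ∀ f {i m} → suc i < m → f i < f (suc i) → AscentAt i (applyUpTo f m)
applyUpTo-ascentAt f {zero}  {suc (suc m)} _         asc = asc
applyUpTo-ascentAt f {zero}  {suc zero}    (s≤s ()) _
applyUpTo-ascentAt f {suc i} {suc m}       (s≤s i<m) asc = applyUpTo-ascentAt (f ∘ suc) i<m asc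

-- Every letter fixes 0, so listing the values on 0,…,n loses nothing and avoids an offset.
inversions-∘act-≤ : ∀ n g w → WordOf n w →
  inversions (applyUpTo (g ∘ act w) (suc n)) ≤ length w + inversions (applyUpTo g (suc n))
inversions-∘act-≤ n g []      []       = ≤-refl
inversions-∘act-≤ n g (i ∷ w) (l ∷ ls) = begin
  inversions (applyUpTo (g ∘ sₜ i ∘ act w) (suc n))
    ≤⟨ inversions-∘act-≤ n (g ∘ sₜ i) w ls ⟩
  length w + inversions (applyUpTo (g ∘ sₜ i) (suc n))
    ≡⟨ cong (λ xs → length w + inversions xs) (applyUpTo-∘sₜ g (s≤s (letter⇒1+i≤n l))) ⟩
  length w + inversions (swapAt i (applyUpTo g (suc n)))
    ≤⟨ +-monoʳ-≤ (length w) (inversions-swapAt-≤ i (applyUpTo g (suc n))) ⟩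
  length w + suc (inversions (applyUpTo g (suc n)))
    ≡⟨ +-suc (length w) _ ⟩
  length (i ∷ w) + inversions (applyUpTo g (suc n)) ∎
  where open ≤-Reasoning

inversions-∘act : ∀ n g w → WordOf n w → Ascending g w →
  inversions (applyUpTo (g ∘ act w) (suc n)) ≡ length w + inversions (applyUpTo g (suc n))
inversions-∘act n g []      []       _               = refl
inversions-∘act n g (i ∷ w) (l ∷ ls) (asc-i , asc-w) = begin
  inversions (applyUpTo (g ∘ sₜ i ∘ act w) (suc n))
    ≡⟨ inversions-∘act n (g ∘ sₜ i) w ls asc-w ⟩
  length w + inversions (applyUpTo (g ∘ sₜ i) (suc n))
    ≡⟨ cong (λ xs → length w + inversions xs) (applyUpTo-∘sₜ g i<1+n) ⟩
  length w + inversions (swapAt i (applyUpTo g (suc n)))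
    ≡⟨ cong (length w +_) (inversions-swapAt i (applyUpTo g (suc n)) (applyUpTo-ascentAt g i<1+n asc-i)) ⟩
  length w + suc (inversions (applyUpTo g (suc n)))
    ≡⟨ +-suc (length w) _ ⟩
  length (i ∷ w) + inversions (applyUpTo g (suc n)) ∎
  where
  open ≡-Reasoning
  i<1+n = s≤s (letter⇒1+i≤n l)

countBelow-applyUpTo : ∀ x f m → (∀ j → x ≤ f j) → countBelow x (applyUpTo f m) ≡ 0
countBelow-applyUpTo x f zero    x≤f = refl
countBelow-applyUpTo x f (suc m) x≤f rewrite dec-false (f 0 <? x) (≤⇒≯ (x≤f 0)) =
  countBelow-applyUpTo x (f ∘ suc) m (x≤f ∘ suc)

inversions-upTo : ∀ m → inversions (upTo m) ≡ 0
inversions-upTo = go 0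
  where
  go : ∀ a m → inversions (applyUpTo (a +_) m) ≡ 0
  go a zero    = refl
  go a (suc m) = cong₂ _+_
    (countBelow-applyUpTo (a + 0) _ m λ j → +-monoʳ-≤ a z≤n)
    (trans (cong inversions (applyUpTo-cong m (+-suc a))) (go (suc a) m))

ascending⇒reduced : ∀ {n w} → WordOf n w → Ascending (λ x → x) w → Reduced n w
ascending⇒reduced {n} {w} word asc = word , λ v word-v v≗w → begin
  length w                                                   ≡⟨ +-identityʳ (length w) ⟨
  length w + 0                                               ≡⟨ cong (length w +_) (inversions-upTo (suc n)) ⟨
  length w + inversions (upTo (suc n))                       ≡⟨ inversions-∘act n (λ x → x) w word asc ⟨
  inversions (applyUpTo (act w) (suc n))                     ≡⟨ cong inversions (applyUpTo-cong (suc n) (sym ∘ v≗w)) ⟩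
  inversions (applyUpTo (act v) (suc n))                     ≤⟨ inversions-∘act-≤ n (λ x → x) v word-v ⟩
  length v + inversions (upTo (suc n))                       ≡⟨ cong (length v +_) (inversions-upTo (suc n)) ⟩
  length v + 0                                               ≡⟨ +-identityʳ (length v) ⟩
  length v                                                   ∎
  where open ≤-Reasoning

inversion-origin : ∀ u {c d i} → c < d → act u i ≡ d → act u (suc i) ≡ c →
  ∃₂ λ u₁ a → Σ (List ℕ) λ u₂ → u ≡ u₁ ++ a ∷ u₂ × act u₁ a ≡ c × act u₁ (suc a) ≡ d
inversion-origin []      {i = i} c<d refl refl = contradiction c<d (<-asym (n<1+n i))
inversion-origin (b ∷ u) {c} {d} c<d eq-d eq-c with c ≟ b ×-dec d ≟ suc b
... | yes (refl , refl) = [] , b , u , refl , refl , refl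
... | no not-swapped
  with inversion-origin u (sₜ-<-mono c<d not-swapped)
         (trans (sym (sₜ-involutive b _)) (cong (sₜ b) eq-d))
         (trans (sym (sₜ-involutive b _)) (cong (sₜ b) eq-c))
...   | u₁ , a , u₂ , refl , eq₁ , eq₂ =
  b ∷ u₁ , a , u₂ , refl ,
  trans (cong (sₜ b) eq₁) (sₜ-involutive b c) , trans (cong (sₜ b) eq₂) (sₜ-involutive b d)

sₜ-conjugate : ∀ φ {i a} → Injective≡ φ → φ i ≡ a → φ (suc i) ≡ suc a →
               ∀ z → sₜ a (φ (sₜ i z)) ≡ φ z
sₜ-conjugate φ {i} {a} φ-inj φi φ1+i z with sₜ-case i z
... | at-i refl   rewrite sₜ-i≡1+i i | φ1+i | φi = sₜ-1+i≡i a
... | at-1+i refl rewrite sₜ-1+i≡i i | φi | φ1+i = sₜ-i≡1+i a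
... | apart p q   rewrite sₜ-fix p q =
  sₜ-fix (λ φz≡a → p (φ-inj (trans φz≡a (sym φi)))) (λ φz≡1+a → q (φ-inj (trans φz≡1+a (sym φ1+i))))

-- A descent at i in a word u s_i v lets us cancel s_i against the letter of u that created it.
descent⇒shorter-word : ∀ {n} u i v → WordOf n (u ++ i ∷ v) → act u (suc i) < act u i →
  Σ (List ℕ) λ w′ → WordOf n w′ × length (u ++ i ∷ v) ≡ 2 + length w′ ×
                    (∀ x → act w′ x ≡ act (u ++ i ∷ v) x)
descent⇒shorter-word {n} u i v word desc with inversion-origin u desc refl refl
... | u₁ , a , u₂ , refl , eq₁ , eq₂ =
  u₁ ++ u₂ ++ v , word′ , len , same-action
  where
  u₂-i≡a : act u₂ i ≡ a
  u₂-i≡a = sₜ-injective a (trans (act-injective u₁ (trans (sym (act-++ u₁ (a ∷ u₂) i)) (sym eq₂)))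
                               (sym (sₜ-i≡1+i a)))
  u₂-1+i≡1+a : act u₂ (suc i) ≡ suc a
  u₂-1+i≡1+a = sₜ-injective a (trans (act-injective u₁ (trans (sym (act-++ u₁ (a ∷ u₂) (suc i))) (sym eq₁)))
                                   (sym (sₜ-1+i≡i a)))
  reassoc : (u₁ ++ a ∷ u₂) ++ v ≡ u₁ ++ a ∷ u₂ ++ v
  reassoc = ++-assoc u₁ (a ∷ u₂) v
  word′ : WordOf n (u₁ ++ u₂ ++ v)
  word′ = All-delete u₁ (subst (WordOf n) reassoc (All-delete u word))
  len : length (u ++ i ∷ v) ≡ 2 + length (u₁ ++ u₂ ++ v)
  len = trans (length-++-sucʳ u i v)
              (cong suc (trans (cong length reassoc) (length-++-sucʳ u₁ a (u₂ ++ v))))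
  same-action : ∀ x → act (u₁ ++ u₂ ++ v) x ≡ act (u ++ i ∷ v) x
  same-action x = begin
    act (u₁ ++ u₂ ++ v) x          ≡⟨ cong (λ w → act w x) (++-assoc u₁ u₂ v) ⟨
    act ((u₁ ++ u₂) ++ v) x        ≡⟨ act-++ (u₁ ++ u₂) v x ⟩
    act (u₁ ++ u₂) (act v x)       ≡⟨ cancel (act v x) ⟨
    act u (sₜ i (act v x))         ≡⟨ act-++ u (i ∷ v) x ⟨
    act (u ++ i ∷ v) x             ∎
    where
    open ≡-Reasoning
    cancel : ∀ y → act u (sₜ i y) ≡ act (u₁ ++ u₂) y
    cancel y = begin
      act u (sₜ i y)                    ≡⟨ act-++ u₁ (a ∷ u₂) (sₜ i y) ⟩
      act u₁ (sₜ a (act u₂ (sₜ i y)))   ≡⟨ cong (act u₁) (sₜ-conjugate (act u₂) (act-injective u₂) u₂-i≡a u₂-1+i≡1+a y) ⟩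
      act u₁ (act u₂ y)                 ≡⟨ act-++ u₁ u₂ y ⟨
      act (u₁ ++ u₂) y                  ∎

reduced⇒ascent : ∀ {n} u i v → Reduced n (u ++ i ∷ v) → act u i < act u (suc i)
reduced⇒ascent {n} u i v (word , minimal) with act u i <? act u (suc i)
... | yes asc = asc
... | no ¬asc with descent⇒shorter-word {n} u i v word desc
  where desc = ≤∧≢⇒< (≮⇒≥ ¬asc) (λ eq → 1+n≢n (act-injective u eq))
...   | w′ , word′ , len , same =
  contradiction (subst (_≤ length w′) len (minimal w′ word′ same)) (1+n≰n ∘ ≤-trans (n≤1+n _))

reduced⇒ascending-suffix : ∀ {n} u v → Reduced n (u ++ v) → Ascending (act u) v
reduced⇒ascending-suffix     u []      _   = tt
reduced⇒ascending-suffix {n} u (i ∷ v) red =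
  reduced⇒ascent {n} u i v red ,
  Ascending-cong v (act-++ u [ i ])
    (reduced⇒ascending-suffix {n} (u ++ [ i ]) v (subst (Reduced n) (sym (++-assoc u [ i ] v)) red))

reduced⇒ascending : ∀ {n w} → Reduced n w → Ascending (λ x → x) w
reduced⇒ascending {n} {w} = reduced⇒ascending-suffix {n} [] w

-- From reduced words to monotone weakly separated paths

ascending-keeps-inversions : ∀ g m {e₁ e₂} → Ascending g m →
  act m e₁ < act m e₂ → g (act m e₂) < g (act m e₁) → e₁ < e₂
ascending-keeps-inversions g []      _               lt _   = lt
ascending-keeps-inversions g (i ∷ m) {e₁} {e₂} (asc-i , asc-m) lt inv =
  ascending-keeps-inversions (g ∘ sₜ i) m asc-m c₁<c₂ inv
  where
  c₁ = act m e₁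
  c₂ = act m e₂
  c₁<c₂ : c₁ < c₂
  c₁<c₂ with <-cmp c₁ c₂
  ... | tri< c₁<c₂ _ _ = c₁<c₂
  ... | tri≈ _ c₁≡c₂ _ = contradiction lt (<-irrefl (cong (sₜ i) c₁≡c₂))
  ... | tri> _ _ c₂<c₁ with c₂ ≟ i ×-dec c₁ ≟ suc i
  ...   | no not-swapped = contradiction lt (<-asym (sₜ-<-mono c₂<c₁ not-swapped))
  ...   | yes (c₂≡i , c₁≡1+i) = contradiction asc-i (<-asym (subst₂ _<_ g-c₂ g-c₁ inv))
    where
    g-c₂ : g (sₜ i c₂) ≡ g (suc i)
    g-c₂ = cong g (trans (cong (sₜ i) c₂≡i) (sₜ-i≡1+i i))
    g-c₁ : g (sₜ i c₁) ≡ g i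
    g-c₁ = cong g (trans (cong (sₜ i) c₁≡1+i) (sₜ-1+i≡i i))

ascending⇒below : ∀ {n k} → k ≤ n → ∀ g m → WordOf n m → Ascending g m →
                  Below (image n k g) (image n k (g ∘ act m))
ascending⇒below {n} {k} k≤n g m word asc x y x∈A─B y∈B─A
  with ∈-image⁻ k g (p─q⊆p _ _ x∈A─B) | ∈-image⁻ k (g ∘ act m) (p─q⊆p _ _ y∈B─A)
... | c , 1≤c , c≤k , gc≡x | d , 1≤d , d≤k , gmd≡y with <-cmp (suc (toℕ x)) (suc (toℕ y))
...   | tri< x<y _ _ = ≤-pred x<y
...   | tri≈ _ x≡y _ = contradiction (subst (_∈ image n k g) (suc-toℕ-injective x≡y) (p─q⊆p _ _ x∈A─B))
                                     (x∈p─q⇒x∉q y∈B─A)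
...   | tri> _ _ y<x = contradiction (ascending-keeps-inversions g m asc c<md gmd<gme) (<-asym (≤-trans (s≤s d≤k) k<e))
  where
  e = act (reverse m) c
  me≡c : act m e ≡ c
  me≡c = act-act-reverse m c
  k<e : k < e
  k<e = ∉-image⇒k< (g ∘ act m) (proj₁ (act-range (All-reverse word) (1≤c , ≤-trans c≤k k≤n)))
          (x∈p─q⇒x∉q x∈A─B) (trans (cong g me≡c) gc≡x)
  k<md : k < act m d
  k<md = ∉-image⇒k< g (proj₁ (act-range word (1≤d , ≤-trans d≤k k≤n))) (x∈p─q⇒x∉q y∈B─A) gmd≡y
  c<md : act m e < act m d
  c<md = subst (_< act m d) (sym me≡c) (≤-trans (s≤s c≤k) k<md)
  gmd<gme : g (act m d) < g (act m e)
  gmd<gme = subst₂ _<_ (sym gmd≡y) (sym (trans (cong g me≡c) gc≡x)) y<x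

prefixesEndingIn-∷⁻ : ∀ k i is {p} → p ∈ₗ prefixesEndingIn k (i ∷ is) →
                      p ≡ [ i ] ⊎ p ∈ₗ map (i ∷_) (prefixesEndingIn k is)
prefixesEndingIn-∷⁻ k i is p∈ with i ≡ᵇ k | p∈
... | true  | here p≡[i] = inj₁ p≡[i]
... | true  | there p∈′ = inj₂ p∈′
... | false | p∈′       = inj₂ p∈′

∈-prefixesEndingIn : ∀ k w {p} → p ∈ₗ prefixesEndingIn k w → ∃ λ v → w ≡ p ++ v
∈-prefixesEndingIn k (i ∷ is) p∈ with prefixesEndingIn-∷⁻ k i is p∈
... | inj₁ refl = is , refl
... | inj₂ p∈′ with ∈-map⁻ (i ∷_) p∈′
...   | p′ , p′∈ , refl = let (v , eq) = ∈-prefixesEndingIn k is p′∈ in v , cong (i ∷_) eq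

∈-Pk : ∀ {n k w I} → I ∈ₗ Pk n k w → ∃₂ λ u v → w ≡ u ++ v × I ≡ image n k (act u)
∈-Pk {w = w} (here refl) = [] , w , refl , refl
∈-Pk {n} {k} {w} (there I∈) with ∈-map⁻ (imageSet n k) I∈
... | p , p∈ , refl = let (v , eq) = ∈-prefixesEndingIn k w p∈ in p , v , eq , refl

prefixes-comparable : ∀ {A : Set} (u₁ : List A) {v₁} u₂ {v₂} → u₁ ++ v₁ ≡ u₂ ++ v₂ →
                      (∃ λ m → u₂ ≡ u₁ ++ m) ⊎ (∃ λ m → u₁ ≡ u₂ ++ m)
prefixes-comparable []       u₂       _  = inj₁ (u₂ , refl)
prefixes-comparable (x ∷ u₁) []       _  = inj₂ (x ∷ u₁ , refl)
prefixes-comparable (x ∷ u₁) (y ∷ u₂) eq with Data.List.Properties.∷-injective eq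
... | refl , eq′ with prefixes-comparable u₁ u₂ eq′
...   | inj₁ (m , refl) = inj₁ (m , refl)
...   | inj₂ (m , refl) = inj₂ (m , refl)

prefix-word : ∀ {n u v w} → w ≡ u ++ v → WordOf n w → Ascending (λ x → x) w →
              WordOf n u × Ascending (λ x → x) u
prefix-word {n} {u} refl word asc = ++⁻ˡ {P = Letter n} u word , proj₁ (Ascending-++⁻ _ u asc)

Below-image-++ : ∀ {n k} → k ≤ n → ∀ u m → WordOf n (u ++ m) → Ascending (λ x → x) (u ++ m) →
                 Below (image n k (act u)) (image n k (act (u ++ m)))
Below-image-++ {n} {k} k≤n u m word asc =
  subst (Below (image n k (act u))) (image-cong k (sym ∘ act-++ u m))
        (ascending⇒below k≤n (act u) m (++⁻ʳ {P = Letter n} u word) (proj₂ (Ascending-++⁻ _ u asc)))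

Pk-weaklySeparated : ∀ {n k w} → k ≤ n → WordOf n w → Ascending (λ x → x) w → WSCollection (Pk n k w)
Pk-weaklySeparated {n} {k} {w} k≤n word asc I∈ J∈ _ with ∈-Pk {n} {k} {w} I∈ | ∈-Pk {n} {k} {w} J∈
... | u₁ , v₁ , eq₁ , refl | u₂ , v₂ , eq₂ , refl with prefixes-comparable u₁ u₂ (trans (sym eq₁) eq₂)
...   | inj₁ (m , refl) = let (word′ , asc′) = prefix-word {n} eq₂ word asc in
  inj₁ (Below-image-++ k≤n u₁ m word′ asc′)
...   | inj₂ (m , refl) = let (word′ , asc′) = prefix-word {n} eq₁ word asc in
  inj₂ (Below-image-++ k≤n u₂ m word′ asc′)

Pk-cardinalities : ∀ {n k w} → k ≤ n → WordOf n w → All (λ A → ∣ A ∣ ≡ k) (Pk n k w)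
Pk-cardinalities {n} {k} {w} k≤n word = All.tabulate card
  where
  card : ∀ {I} → I ∈ₗ Pk n k w → ∣ I ∣ ≡ k
  card I∈ with ∈-Pk {n} {k} {w} I∈
  ... | u , v , refl , refl = ∣image-act∣≡k k≤n (++⁻ˡ {P = Letter n} u word)

─≡⁅_⁆ : ∀ {n} {p q : Subset n} {x} → x ∈ p → x ∉ q → (∀ {z} → z ∈ p ─ q → z ≡ x) → p ─ q ≡ ⁅ x ⁆
─≡⁅_⁆ {x = x} x∈p x∉q unique = ⊆-antisym
  (λ z∈ → subst (_∈ ⁅ x ⁆) (sym (unique z∈)) (x∈⁅x⁆ x))
  (λ z∈ → subst (_∈ _) (sym (x∈⁅y⁆⇒x≡y x z∈)) (x∈p∧x∉q⇒x∈p─q x∈p x∉q))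

image-─-last : ∀ {n k} g h → 1 ≤ k → (r : InRange n (g k)) → (∀ {c} → c < k → g c ≡ h c) →
               ¬ Attains k h (g k) → image n k g ─ image n k h ≡ ⁅ toFin r ⁆
image-─-last {n} {k} g h 1≤k r g≗h-below ¬attains = ─≡⁅ x∈ ⁆ x∉ unique
  where
  value = suc-toℕ-toFin r
  x∈ = ∈-image⁺ g (k , 1≤k , ≤-refl , sym value)
  x∉ = λ x∈h → ¬attains (subst (Attains k h) value (∈-image⁻ k h x∈h))
  unique : ∀ {z} → z ∈ image n k g ─ image n k h → z ≡ toFin r
  unique z∈ with ∈-image⁻ k g (p─q⊆p _ _ z∈)
  ... | c , 1≤c , c≤k , gc≡z with m≤n⇒m<n∨m≡n c≤k
  ...   | inj₂ refl = suc-toℕ-injective (trans (sym gc≡z) (sym value))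
  ...   | inj₁ c<k  = contradiction (∈-image⁺ h (c , 1≤c , ≤-pred (m≤n⇒m≤1+n c<k) , trans (sym (g≗h-below c<k)) gc≡z))
                                    (x∈p─q⇒x∉q z∈)

monotoneStep-∘sₜ : ∀ {n k} g → Injective≡ g → 1 ≤ k → InRange n (g k) → InRange n (g (suc k)) →
                   g k < g (suc k) → MonotoneStep (image n k g) (image n k (g ∘ sₜ k))
monotoneStep-∘sₜ {n} {k} g g-inj 1≤k rₖ r₁₊ₖ asc = toFin r′ , toFin rₖ , B─A , A─B , y<x
  where
  r′ : InRange n (g (sₜ k k))
  r′ = subst (InRange n ∘ g) (sym (sₜ-i≡1+i k)) r₁₊ₖ
  fixed-below : ∀ {c} → c < k → g c ≡ g (sₜ k c)
  fixed-below c<k = cong g (sym (sₜ-fix-below c<k))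
  A─B = image-─-last g (g ∘ sₜ k) 1≤k rₖ fixed-below
    λ (c , _ , c≤k , eq) → 1+n≰n (subst (_≤ k) (sₜ≡i⇒≡1+i (g-inj eq)) c≤k)
  B─A = image-─-last (g ∘ sₜ k) g 1≤k r′ (sym ∘ fixed-below)
    λ (c , _ , c≤k , eq) → 1+n≰n (subst (_≤ k) (trans (g-inj eq) (sₜ-i≡1+i k)) c≤k)
  y<x : toFin rₖ F.< toFin r′
  y<x = ≤-pred (subst₂ _<_ (sym (suc-toℕ-toFin rₖ))
                           (sym (trans (suc-toℕ-toFin r′) (cong g (sₜ-i≡1+i k)))) asc)

imagesAlong : ∀ n k → (ℕ → ℕ) → List ℕ → List (Subset n)
imagesAlong n k g w = map (λ p → image n k (g ∘ act p)) (prefixesEndingIn k w)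

imagesAlong-∷-k : ∀ n k g is →
  imagesAlong n k g (k ∷ is) ≡ image n k (g ∘ sₜ k) ∷ imagesAlong n k (g ∘ sₜ k) is
imagesAlong-∷-k n k g is rewrite ≡⇒≡ᵇ≡true (refl {x = k}) =
  cong (_ ∷_) (sym (map-∘ (prefixesEndingIn k is)))

imagesAlong-∷-≢ : ∀ n {k i} g is → i ≢ k → imagesAlong n k g (i ∷ is) ≡ imagesAlong n k (g ∘ sₜ i) is
imagesAlong-∷-≢ n {k} g is i≢k rewrite ≢⇒≡ᵇ≡false i≢k = sym (map-∘ (prefixesEndingIn k is))

imagesAlong-linked : ∀ {n k} g w → Injective≡ g → (∀ {c} → InRange n c → InRange n (g c)) →
  WordOf n w → Ascending g w → Linked MonotoneStep (image n k g ∷ imagesAlong n k g w)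
imagesAlong-linked         g []       _     _       _        _               = [-]
imagesAlong-linked {n} {k} g (i ∷ is) g-inj g-range (l ∷ ls) (asc-i , asc-is) with i ≟ k
... | yes refl rewrite imagesAlong-∷-k n i g is =
  monotoneStep-∘sₜ g g-inj (proj₁ l) (g-range (proj₁ l , ≤-trans (n≤1+n i) (letter⇒1+i≤n l)))
                   (g-range (s≤s z≤n , letter⇒1+i≤n l)) asc-i ∷ rest
  where rest = imagesAlong-linked (g ∘ sₜ i) is (sₜ-injective i ∘ g-inj) (g-range ∘ sₜ-range l) ls asc-is
... | no i≢k rewrite imagesAlong-∷-≢ n g is i≢k =
  subst (λ A → Linked MonotoneStep (A ∷ imagesAlong n k (g ∘ sₜ i) is)) (image-∘sₜ g (proj₁ l) i≢k)
        (imagesAlong-linked (g ∘ sₜ i) is (sₜ-injective i ∘ g-inj) (g-range ∘ sₜ-range l) ls asc-is)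

reduced⇒monotoneWSPath : ∀ {n k w} → k ≤ n → Reduced n w → MonotoneWSPath n k (Pk n k w)
reduced⇒monotoneWSPath {n} {k} {w} k≤n red@(word , _) =
  Pk-cardinalities k≤n word , Pk-weaklySeparated k≤n word asc ,
  imagesAlong-linked (λ x → x) w (λ eq → eq) (λ r → r) word asc
  where asc = reduced⇒ascending {n} red

-- From monotone weakly separated paths to reduced words

rising : ℕ → ℕ → List ℕ
rising a zero    = []
rising a (suc l) = a ∷ rising (suc a) l

falling : ℕ → ℕ → List ℕ
falling a l = reverse (rising a l)

rising-letters : ∀ a l → All (λ i → a ≤ i × i < a + l) (rising a l)
rising-letters a zero    = []
rising-letters a (suc l) =
  (≤-refl , subst (a <_) (sym (+-suc a l)) (s≤s (m≤m+n a l))) ∷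
  All.map (λ {i} (a<i , i<) → <⇒≤ a<i , subst (i <_) (sym (+-suc a l)) i<) (rising-letters (suc a) l)

act-rising-below : ∀ a l {c} → c < a → act (rising a l) c ≡ c
act-rising-below a zero    c<a = refl
act-rising-below a (suc l) c<a
  rewrite act-rising-below (suc a) l (m<n⇒m<1+n c<a) = sₜ-fix-below c<a

act-rising-above : ∀ a l {c} → a + l < c → act (rising a l) c ≡ c
act-rising-above a zero    _       = refl
act-rising-above a (suc l) {c} a+l+1<c =
  trans (cong (sₜ a) (act-rising-above (suc a) l a+1+l<c)) (sₜ-fix-above (≤-trans (s≤s (s≤s (m≤m+n a l))) a+1+l<c))
  where a+1+l<c = subst (_< c) (+-suc a l) a+l+1<c

act-rising-inside : ∀ a l {c} → a ≤ c → c < a + l → act (rising a l) c ≡ suc c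
act-rising-inside a zero    a≤c c<a rewrite +-identityʳ a = contradiction a≤c (<⇒≱ c<a)
act-rising-inside a (suc l) {c} a≤c c<a+l+1 with m≤n⇒m<n∨m≡n a≤c
... | inj₂ refl rewrite act-rising-below (suc a) l (n<1+n a) = sₜ-i≡1+i a
... | inj₁ a<c  rewrite act-rising-inside (suc a) l a<c (subst (c <_) (+-suc a l) c<a+l+1) =
  sₜ-fix-above (s≤s a<c)

act-rising-top : ∀ a l → act (rising a l) (a + l) ≡ a
act-rising-top a zero    = +-identityʳ a
act-rising-top a (suc l) rewrite +-suc a l | act-rising-top (suc a) l = sₜ-1+i≡i a

act-falling-outside : ∀ a l {c} → c < a ⊎ a + l < c → act (falling a l) c ≡ c
act-falling-outside a l (inj₁ c<a)   = act-reverse-≡ (rising a l) (act-rising-below a l c<a)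
act-falling-outside a l (inj₂ a+l<c) = act-reverse-≡ (rising a l) (act-rising-above a l a+l<c)

act-falling-inside : ∀ a l {c} → a ≤ c → c < a + l → act (falling a l) (suc c) ≡ c
act-falling-inside a l a≤c c<a+l = act-reverse-≡ (rising a l) (act-rising-inside a l a≤c c<a+l)

act-falling-bottom : ∀ a l → act (falling a l) a ≡ a + l
act-falling-bottom a l = act-reverse-≡ (rising a l) (act-rising-top a l)

Ascending-rising : ∀ f a l → (∀ {p} → a < p → p ≤ a + l → f a < f p) → Ascending f (rising a l)
Ascending-rising f a zero    _   = tt
Ascending-rising f a (suc l) hyp =
  hyp (n<1+n a) (subst (suc a ≤_) (sym (+-suc a l)) (s≤s (m≤m+n a l))) ,
  Ascending-rising (f ∘ sₜ a) (suc a) l λ {p} a+1<p p≤ →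
    subst₂ (λ x y → f x < f y) (sym (sₜ-1+i≡i a)) (sym (sₜ-fix-above a+1<p))
           (hyp (<-trans (n<1+n a) a+1<p) (subst (p ≤_) (sym (+-suc a l)) p≤))

Ascending-falling : ∀ f a l → (∀ {p} → a ≤ p → p < a + l → f p < f (a + l)) → Ascending f (falling a l)
Ascending-falling f a zero    _   = tt
Ascending-falling f a (suc l) hyp rewrite unfold-reverse a (rising (suc a) l) =
  Ascending-++⁺ f (falling (suc a) l)
    (Ascending-falling f (suc a) l λ {p} a+1≤p p< →
       subst (λ y → f p < f y) (+-suc a l) (hyp (<⇒≤ a+1≤p) (subst (p <_) (sym (+-suc a l)) p<)))
    (subst₂ (λ x y → f x < f y) (sym (act-falling-outside (suc a) l (inj₁ (n<1+n a))))
            (sym (trans (act-falling-bottom (suc a) l) (sym (+-suc a l))))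
            (hyp ≤-refl (subst (a <_) (sym (+-suc a l)) (s≤s (m≤m+n a l)))) , tt)

prefixesEndingIn-++ : ∀ k u v →
  prefixesEndingIn k (u ++ v) ≡ prefixesEndingIn k u ++ map (u ++_) (prefixesEndingIn k v)
prefixesEndingIn-++ k []      v = sym (map-id (prefixesEndingIn k v))
prefixesEndingIn-++ k (i ∷ u) v with i ≡ᵇ k
... | true  = cong ([ i ] ∷_) shifted
  where shifted = trans (cong (map (i ∷_)) (prefixesEndingIn-++ k u v))
                  (trans (map-++ (i ∷_) (prefixesEndingIn k u) _)
                         (cong (map (i ∷_) (prefixesEndingIn k u) ++_) (sym (map-∘ (prefixesEndingIn k v)))))
... | false = trans (cong (map (i ∷_)) (prefixesEndingIn-++ k u v))
              (trans (map-++ (i ∷_) (prefixesEndingIn k u) _)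
                     (cong (map (i ∷_) (prefixesEndingIn k u) ++_) (sym (map-∘ (prefixesEndingIn k v)))))

prefixesEndingIn-none : ∀ {k w} → All (_≢ k) w → prefixesEndingIn k w ≡ []
prefixesEndingIn-none {k} {[]}    []           = refl
prefixesEndingIn-none {k} {i ∷ w} (i≢k ∷ none) rewrite ≢⇒≡ᵇ≡false i≢k | prefixesEndingIn-none none = refl

Pk-++ : ∀ {n k} u v → prefixesEndingIn k v ≡ [ v ] →
        Pk n k (u ++ v) ≡ Pk n k u ++ [ image n k (act (u ++ v)) ]
Pk-++ {n} {k} u v pv rewrite prefixesEndingIn-++ k u v | pv =
  cong (image n k (λ x → x) ∷_) (map-++ (imageSet n k) (prefixesEndingIn k u) _)

-- The word that moves the entry at position a (≤ k) to position k + 1 and the entry at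
-- position b (> k) to position k, shifting the entries in between by one step.
module Block {a k b : ℕ} (a≤k : a ≤ k) (k<b : k < b) where

  private
    l = k ∸ a
    r = b ∸ suc k
    a+l≡k : a + l ≡ k
    a+l≡k = m+[n∸m]≡n a≤k
    k+1+r≡b : suc k + r ≡ b
    k+1+r≡b = m+[n∸m]≡n k<b
    ρ = act (rising a l)
    φ = act (falling (suc k) r)

  block : List ℕ
  block = rising a l ++ falling (suc k) r ++ [ k ]

  π : ℕ → ℕ
  π = act block

  π-unfold : ∀ c → π c ≡ ρ (φ (sₜ k c))
  π-unfold c = trans (act-++ (rising a l) _ c) (cong ρ (act-++ (falling (suc k) r) [ k ] c))

  π-below : ∀ {c} → c < a → π c ≡ c
  π-below {c} c<a rewrite π-unfold c | sₜ-fix-below (≤-trans c<a a≤k)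
    | act-falling-outside (suc k) r (inj₁ (≤-trans c<a (m≤n⇒m≤1+n a≤k))) = act-rising-below a l c<a

  π-left : ∀ {c} → a ≤ c → c < k → π c ≡ suc c
  π-left {c} a≤c c<k rewrite π-unfold c | sₜ-fix-below c<k
    | act-falling-outside (suc k) r (inj₁ (m<n⇒m<1+n c<k)) =
    act-rising-inside a l a≤c (subst (c <_) (sym a+l≡k) c<k)

  π-k : π k ≡ b
  π-k rewrite π-unfold k | sₜ-i≡1+i k | act-falling-bottom (suc k) r | k+1+r≡b =
    act-rising-above a l (subst (_< b) (sym a+l≡k) k<b)

  π-1+k : π (suc k) ≡ a
  π-1+k rewrite π-unfold (suc k) | sₜ-1+i≡i k | act-falling-outside (suc k) r (inj₁ (n<1+n k)) =
    subst (λ c → ρ c ≡ a) a+l≡k (act-rising-top a l)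

  π-right : ∀ {c} → suc k ≤ c → c < b → π (suc c) ≡ c
  π-right {c} k<c c<b rewrite π-unfold (suc c) | sₜ-fix-above (s≤s k<c)
    | act-falling-inside (suc k) r k<c (subst (c <_) (sym k+1+r≡b) c<b) =
    act-rising-above a l (subst (_< c) (sym a+l≡k) k<c)

  π-above : ∀ {c} → b < c → π c ≡ c
  π-above {c} b<c rewrite π-unfold c | sₜ-fix-above (≤-trans (s≤s k<b) b<c)
    | act-falling-outside (suc k) r (inj₂ (subst (_< c) (sym k+1+r≡b) b<c)) =
    act-rising-above a l (subst (_< c) (sym a+l≡k) (<-trans k<b b<c))

  Ascending-block : ∀ f → (∀ {p} → a < p → p ≤ k → f a < f p) → (∀ {p} → k < p → p < b → f p < f b) →
                    f a < f b → Ascending f block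
  Ascending-block f hyp-left hyp-right corner =
    Ascending-++⁺ f (rising a l)
      (Ascending-rising f a l λ a<p p≤ → hyp-left a<p (subst (_ ≤_) a+l≡k p≤))
      (Ascending-++⁺ (f ∘ ρ) (falling (suc k) r)
        (Ascending-falling (f ∘ ρ) (suc k) r λ {p} k<p p< →
          subst₂ (λ x y → f x < f y) (sym (ρ-fix k<p)) (sym (trans (ρ-fix (m≤m+n (suc k) r)) k+1+r≡b))
                 (hyp-right k<p (subst (p <_) k+1+r≡b p<)))
        (subst₂ (λ x y → f x < f y) (sym ρφk≡a) (sym ρφ1+k≡b) corner , tt))
    where
    ρ-fix : ∀ {p} → k < p → ρ p ≡ p
    ρ-fix k<p = act-rising-above a l (subst (_< _) (sym a+l≡k) k<p)
    ρφk≡a : ρ (φ k) ≡ a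
    ρφk≡a rewrite act-falling-outside (suc k) r (inj₁ (n<1+n k)) =
      subst (λ c → ρ c ≡ a) a+l≡k (act-rising-top a l)
    ρφ1+k≡b : ρ (φ (suc k)) ≡ b
    ρφ1+k≡b rewrite act-falling-bottom (suc k) r | k+1+r≡b = ρ-fix k<b

  prefixesEndingIn-block : prefixesEndingIn k block ≡ [ block ]
  prefixesEndingIn-block
    rewrite prefixesEndingIn-++ k (rising a l) (falling (suc k) r ++ [ k ])
          | prefixesEndingIn-++ k (falling (suc k) r) [ k ]
          | prefixesEndingIn-none (All.map (λ (_ , i<) → <⇒≢ (subst (_ <_) a+l≡k i<)) (rising-letters a l))
          | prefixesEndingIn-none (All.map (λ (k<i , _) → <⇒≢ k<i ∘ sym) (All-reverse (rising-letters (suc k) r)))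
          | ≡⇒≡ᵇ≡true (refl {x = k}) = refl

  block-word : ∀ {n} → 1 ≤ a → b ≤ n → WordOf n block
  block-word {n} 1≤a b≤n =
    ++⁺ (All.map (λ (a≤i , i<) → <⇒letter (≤-trans 1≤a a≤i) (<-trans (subst (_ <_) a+l≡k i<) k<n))
                 (rising-letters a l))
        (++⁺ (All.map (λ (k<i , i<) → <⇒letter (≤-trans (s≤s z≤n) k<i) (≤-trans (subst (_ <_) k+1+r≡b i<) b≤n))
                      (All-reverse (rising-letters (suc k) r)))
             (<⇒letter (≤-trans 1≤a a≤k) k<n ∷ []))
    where k<n = ≤-trans k<b b≤n

  π-left-cases : ∀ {c} → c < k → c < a × π c ≡ c ⊎ a ≤ c × π c ≡ suc c
  π-left-cases {c} c<k with c <? a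
  ... | yes c<a = inj₁ (c<a , π-below c<a)
  ... | no  c≮a = inj₂ (≮⇒≥ c≮a , π-left (≮⇒≥ c≮a) c<k)

  π-left-range : ∀ {c} → 1 ≤ c → c < k → 1 ≤ π c × π c ≤ k
  π-left-range 1≤c c<k with π-left-cases c<k
  ... | inj₁ (_ , eq) rewrite eq = 1≤c , <⇒≤ c<k
  ... | inj₂ (_ , eq) rewrite eq = s≤s z≤n , c<k

  π-left-≢a : ∀ {c} → c < k → π c ≢ a
  π-left-≢a c<k with π-left-cases c<k
  ... | inj₁ (c<a , eq) = <⇒≢ c<a ∘ trans (sym eq)
  ... | inj₂ (a≤c , eq) = <⇒≢ (s≤s a≤c) ∘ sym ∘ trans (sym eq)

  π-left-mono : ∀ {c d} → c < d → d < k → π c < π d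
  π-left-mono c<d d<k with π-left-cases (<-trans c<d d<k) | π-left-cases d<k
  ... | inj₁ (_ , eq₁)   | inj₁ (_ , eq₂)   rewrite eq₁ | eq₂ = c<d
  ... | inj₁ (_ , eq₁)   | inj₂ (_ , eq₂)   rewrite eq₁ | eq₂ = m<n⇒m<1+n c<d
  ... | inj₂ (a≤c , _)   | inj₁ (d<a , _)   = contradiction (<-trans c<d d<a) (≤⇒≯ a≤c)
  ... | inj₂ (_ , eq₁)   | inj₂ (_ , eq₂)   rewrite eq₁ | eq₂ = s≤s c<d

  π-right-cases : ∀ {c} → suc k < c → c ≤ b × suc (π c) ≡ c ⊎ b < c × π c ≡ c
  π-right-cases {suc c} (s≤s k<c) with c <? b
  ... | yes c<b = inj₁ (c<b , cong suc (π-right k<c c<b))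
  ... | no  c≮b = inj₂ (s≤s (≮⇒≥ c≮b) , π-above (s≤s (≮⇒≥ c≮b)))

  π-right-range : ∀ {c} → suc k < c → k < π c × π c ≤ c
  π-right-range {c} k+1<c with π-right-cases k+1<c
  ... | inj₁ (_ , eq) = ≤-pred (subst (suc k <_) (sym eq) k+1<c) , subst (π c ≤_) eq (n≤1+n (π c))
  ... | inj₂ (_ , eq) rewrite eq = <-trans (n<1+n _) k+1<c , ≤-refl

  π-right-mono : ∀ {c d} → suc k < c → c < d → π c < π d
  π-right-mono k+1<c c<d with π-right-cases k+1<c | π-right-cases (<-trans k+1<c c<d)
  ... | inj₁ (_ , eq₁) | inj₁ (_ , eq₂) = ≤-pred (subst₂ _<_ (sym eq₁) (sym eq₂) c<d)
  ... | inj₁ (_ , eq₁) | inj₂ (_ , eq₂) rewrite eq₂ = subst (_≤ _) (sym eq₁) (<⇒≤ c<d)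
  ... | inj₂ (b<c , _) | inj₁ (d≤b , _) = contradiction (<-trans b<c c<d) (≤⇒≯ d≤b)
  ... | inj₂ (_ , eq₁) | inj₂ (_ , eq₂) rewrite eq₁ | eq₂ = c<d

module MonotoneStepFacts {n} {A B : Subset n} (step : MonotoneStep A B) where

  x : Fin n
  x = proj₁ step

  y : Fin n
  y = proj₁ (proj₂ step)

  private
    B─A≡⁅x⁆ = proj₁ (proj₂ (proj₂ step))
    A─B≡⁅y⁆ = proj₁ (proj₂ (proj₂ (proj₂ step)))

  y<x : y F.< x
  y<x = proj₂ (proj₂ (proj₂ (proj₂ step)))

  x∈B─A : x ∈ B ─ A
  x∈B─A = subst (x ∈_) (sym B─A≡⁅x⁆) (x∈⁅x⁆ x)

  y∈A─B : y ∈ A ─ B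
  y∈A─B = subst (y ∈_) (sym A─B≡⁅y⁆) (x∈⁅x⁆ y)

  ∈B⇒∈A : ∀ {z} → z ∈ B → z ≢ x → z ∈ A
  ∈B⇒∈A {z} z∈B z≢x with z ∈? A
  ... | yes z∈A = z∈A
  ... | no  z∉A = contradiction (x∈⁅y⁆⇒x≡y x (subst (z ∈_) B─A≡⁅x⁆ (x∈p∧x∉q⇒x∈p─q z∈B z∉A))) z≢x

  ∈A⇒∈B : ∀ {z} → z ∈ A → z ≢ y → z ∈ B
  ∈A⇒∈B {z} z∈A z≢y with z ∈? B
  ... | yes z∈B = z∈B
  ... | no  z∉B = contradiction (x∈⁅y⁆⇒x≡y y (subst (z ∈_) A─B≡⁅y⁆ (x∈p∧x∉q⇒x∈p─q z∈A z∉B))) z≢y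

  private
    x∈B = p─q⊆p _ _ x∈B─A
    x∉A = x∈p─q⇒x∉q x∈B─A
    y∈A = p─q⊆p _ _ y∈A─B
    y∉B = x∈p─q⇒x∉q y∈A─B
    y∈C─B : ∀ {C} → y ∈ C → y ∈ C ─ B
    y∈C─B y∈C = x∈p∧x∉q⇒x∈p─q y∈C y∉B
    cycle : ∀ {z} → x F.< z → z F.< y → ⊥
    cycle x<z z<y = <-irreflᶠ refl (<-transᶠ y<x (<-transᶠ x<z z<y))

  -- The alternative Below B C would, together with Below C A, close a cycle
  -- y < x < t < y or y < x < s < y.
  separated-below : ∀ {C s t} → WeaklySeparated C B → Below C A → s ∈ C ─ B → t ∈ B ─ C → s F.< t
  separated-below (inj₁ C<B) _ s∈ t∈ = C<B _ _ s∈ t∈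
  separated-below {C} {s} {t} (inj₂ B<C) C<A s∈ t∈ with x ∈? C | y ∈? C
  ... | no x∉C  | yes y∈C = contradiction y<x (<-asymᶠ (B<C x y (x∈p∧x∉q⇒x∈p─q x∈B x∉C) (y∈C─B y∈C)))
  ... | yes x∈C | no y∉C  = contradiction y<x (<-asymᶠ (C<A x y (x∈p∧x∉q⇒x∈p─q x∈C x∉A) (x∈p∧x∉q⇒x∈p─q y∈A y∉C)))
  ... | yes x∈C | yes y∈C = ⊥-elim (cycle (C<A x t (x∈p∧x∉q⇒x∈p─q x∈C x∉A) (x∈p∧x∉q⇒x∈p─q t∈A t∉C))
                                  (B<C t y t∈ (y∈C─B y∈C)))
    where
    t∉C = x∈p─q⇒x∉q t∈
    t∈A = ∈B⇒∈A (p─q⊆p _ _ t∈) λ t≡x → t∉C (subst (_∈ C) (sym t≡x) x∈C)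
  ... | no x∉C  | no y∉C  = ⊥-elim (cycle (B<C x s (x∈p∧x∉q⇒x∈p─q x∈B x∉C) s∈)
                                  (C<A s y (x∈p∧x∉q⇒x∈p─q (p─q⊆p _ _ s∈) s∉A) (x∈p∧x∉q⇒x∈p─q y∈A y∉C)))
    where
    s∉A : s ∉ A
    s∉A s∈A = x∈p─q⇒x∉q s∈ (∈A⇒∈B s∈A λ s≡y → y∉C (subst (_∈ C) s≡y (p─q⊆p _ _ s∈)))

module Converse {n k : ℕ} (k≤n : k ≤ n) (P : List (Subset n)) (P-ws : WSCollection P) where

  Separated : List ℕ → ℕ → ℕ → Set
  Separated u p q = ∃₂ λ u₀ m → u ≡ u₀ ++ m × image n k (act u₀) ∈ₗ P ×
                                Attains k (act u₀) p × ¬ Attains k (act u₀) q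

  SameSide : ℕ → ℕ → Set
  SameSide c d = d ≤ k ⊎ k < c × d ≤ n

  InversionsSeparated : List ℕ → Set
  InversionsSeparated u = ∀ {c d} → 1 ≤ c → c < d → SameSide c d → act u d < act u c →
                          Separated u (act u c) (act u d)

  record Admissible (u : List ℕ) : Set where
    field
      word      : WordOf n u
      ascending : Ascending (λ x → x) u
      image∈P   : image n k (act u) ∈ₗ P
      separated : InversionsSeparated u

  module Extend {u B} (adm : Admissible u) (B∈P : B ∈ₗ P) (step : MonotoneStep (image n k (act u)) B) where
    open Admissible adm
    open MonotoneStepFacts step

    private
      f = act u
      A = image n k f
      f-inj = act-injective u

      entry : ∀ {p} → InRange n p → Fin n
      entry r = toFin (act-range word r)

      entry≡ : ∀ {p} (r : InRange n p) → suc (toℕ (entry r)) ≡ f p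
      entry≡ r = suc-toℕ-toFin (act-range word r)

      attains⇒∈ : ∀ g {z v} → suc (toℕ z) ≡ v → Attains k g v → z ∈ image n k g
      attains⇒∈ g z≡v att = ∈-image⁺ g (subst (Attains k g) (sym z≡v) att)

      ∈⇒attains : ∀ g {z v} → suc (toℕ z) ≡ v → z ∈ image n k g → Attains k g v
      ∈⇒attains g z≡v z∈ = subst (Attains k g) z≡v (∈-image⁻ k g z∈)

      attained : ∀ {p} → 1 ≤ p → p ≤ k → Attains k f (f p)
      attained 1≤p p≤k = _ , 1≤p , p≤k , refl

      unattained : ∀ {p} → k < p → ¬ Attains k f (f p)
      unattained k<p (c , _ , c≤k , fc≡fp) = contradiction (subst (_≤ k) (f-inj fc≡fp) c≤k) (<⇒≱ k<p)

      same-entry : ∀ {z w : Fin n} {p q} → suc (toℕ z) ≡ f p → suc (toℕ w) ≡ f q → z ≡ w → p ≡ q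
      same-entry z≡fp w≡fq refl = f-inj (trans (sym z≡fp) w≡fq)

      y∈A = p─q⊆p _ _ y∈A─B
      y∉B = x∈p─q⇒x∉q y∈A─B
      x∈B = p─q⊆p _ _ x∈B─A
      x∉A = x∈p─q⇒x∉q x∈B─A

      a-attains = ∈-image⁻ k f y∈A
      a = proj₁ a-attains
      1≤a = proj₁ (proj₂ a-attains)
      a≤k = proj₁ (proj₂ (proj₂ a-attains))
      fa≡y = proj₂ (proj₂ (proj₂ a-attains))

      b = act (reverse u) (suc (toℕ x))
      fb≡x : f b ≡ suc (toℕ x)
      fb≡x = act-act-reverse u _
      b-range : InRange n b
      b-range = act-range (All-reverse word) (s≤s z≤n , toℕ<n x)
      k<b : k < b
      k<b = ∉-image⇒k< f (proj₁ b-range) x∉A fb≡x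

      earlier-below : ∀ {u₀ m} → u ≡ u₀ ++ m → Below (image n k (act u₀)) A
      earlier-below {u₀} {m} u≡ = subst (λ w → Below (image n k (act u₀)) (image n k (act w))) (sym u≡)
        (Below-image-++ k≤n u₀ m (subst (WordOf n) u≡ word) (subst (Ascending (λ x → x)) u≡ ascending))

      earlier-separates : ∀ {u₀ m s t} → u ≡ u₀ ++ m → image n k (act u₀) ∈ₗ P →
                          s ∈ image n k (act u₀) → s ∉ B → t ∉ image n k (act u₀) → t ∈ B → s F.< t
      earlier-separates {u₀} {m} u≡ C∈P s∈C s∉B t∉C t∈B =
        separated-below (P-ws C∈P B∈P λ C≡B → s∉B (subst (_ ∈_) C≡B s∈C)) (earlier-below {u₀} {m} u≡)
                        (x∈p∧x∉q⇒x∈p─q s∈C s∉B) (x∈p∧x∉q⇒x∈p─q t∈B t∉C)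

      left-ascent : ∀ {p} → a < p → p ≤ k → f a < f p
      left-ascent {p} a<p p≤k with f a <? f p
      ... | yes asc = asc
      ... | no ¬asc with separated 1≤a a<p (inj₁ p≤k) (≤∧≢⇒< (≮⇒≥ ¬asc) (<⇒≢ a<p ∘ sym ∘ f-inj))
      ...   | u₀ , m , u≡ , C∈P , y-in , p-out = contradiction (subst₂ _<_ (sym fa≡y) (entry≡ r) (s≤s y<z)) ¬asc
        where
        r = ≤-trans 1≤a (<⇒≤ a<p) , ≤-trans p≤k k≤n
        y<z = earlier-separates {u₀} {m} u≡ C∈P (attains⇒∈ (act u₀) (sym fa≡y) y-in) y∉B
                (p-out ∘ ∈⇒attains (act u₀) (entry≡ r))
                (∈A⇒∈B (attains⇒∈ f (entry≡ r) (attained (proj₁ r) p≤k))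
                       (<⇒≢ a<p ∘ sym ∘ same-entry (entry≡ r) (sym fa≡y)))

      right-ascent : ∀ {p} → k < p → p < b → f p < f b
      right-ascent {p} k<p p<b with f p <? f b
      ... | yes asc = asc
      ... | no ¬asc with separated (≤-trans (s≤s z≤n) k<p) p<b (inj₂ (k<p , proj₂ b-range))
                                   (≤∧≢⇒< (≮⇒≥ ¬asc) (<⇒≢ p<b ∘ f-inj ∘ sym))
      ...   | u₀ , m , u≡ , C∈P , p-in , b-out = contradiction (subst₂ _<_ (entry≡ r) (sym fb≡x) (s≤s z<x)) ¬asc
        where
        r = ≤-trans (s≤s z≤n) k<p , ≤-trans (<⇒≤ p<b) (proj₂ b-range)
        z∉A = unattained k<p ∘ ∈⇒attains f (entry≡ r)
        z<x = earlier-separates {u₀} {m} u≡ C∈P (attains⇒∈ (act u₀) (entry≡ r) p-in)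
                (λ z∈B → z∉A (∈B⇒∈A z∈B (<⇒≢ p<b ∘ same-entry (entry≡ r) (sym fb≡x))))
                (b-out ∘ ∈⇒attains (act u₀) (sym fb≡x)) x∈B

      corner : f a < f b
      corner = subst₂ _<_ (sym fa≡y) (sym fb≡x) (s≤s y<x)

    open Block a≤k k<b public

    private
      f∘π : ∀ c → act (u ++ block) c ≡ f (π c)
      f∘π = act-++ u block

      shifted-down : ∀ {c} → a < c → c ≤ k → Attains k (f ∘ π) (f c)
      shifted-down {suc c} (s≤s a≤c) c<k = c , ≤-trans 1≤a a≤c , ≤-trans (n≤1+n c) c<k , cong f (π-left a≤c c<k)

    image≡B : image n k (act (u ++ block)) ≡ B
    image≡B = trans (image-cong k f∘π) (⊆-antisym to from)
      where
      to : image n k (f ∘ π) ⊆ B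
      to z∈ with ∈-image⁻ k (f ∘ π) z∈
      ... | c , 1≤c , c≤k , eq with m≤n⇒m<n∨m≡n c≤k
      ...   | inj₂ refl = subst (_∈ B) (suc-toℕ-injective (trans (sym fb≡x) (trans (cong f (sym π-k)) eq))) x∈B
      ...   | inj₁ c<k  = let (1≤πc , πc≤k) = π-left-range 1≤c c<k in
        ∈A⇒∈B (attains⇒∈ f (sym eq) (attained 1≤πc πc≤k))
              (π-left-≢a c<k ∘ same-entry (sym eq) (sym fa≡y))
      from : B ⊆ image n k (f ∘ π)
      from {z} z∈B with z F.≟ x
      ... | yes refl = attains⇒∈ (f ∘ π) (sym fb≡x) (k , ≤-trans 1≤a a≤k , ≤-refl , cong f π-k)
      ... | no z≢x with ∈-image⁻ k f (∈B⇒∈A z∈B z≢x)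
      ...   | c , 1≤c , c≤k , eq with <-cmp c a
      ...     | tri< c<a _ _ = ∈-image⁺ (f ∘ π) (c , 1≤c , c≤k , trans (cong f (π-below c<a)) eq)
      ...     | tri≈ _ refl _ = contradiction (subst (_∈ B) (suc-toℕ-injective (trans (sym eq) fa≡y)) z∈B) y∉B
      ...     | tri> _ _ a<c = attains⇒∈ (f ∘ π) (sym eq) (shifted-down a<c c≤k)

    private
      extend-separation : ∀ {p q} → Separated u p q → Separated (u ++ block) p q
      extend-separation (u₀ , m , u≡ , C∈P , p-in , q-out) =
        u₀ , m ++ block , trans (cong (_++ block) u≡) (++-assoc u₀ m block) , C∈P , p-in , q-out

      separated-by-A : ∀ {p q} → Attains k f p → ¬ Attains k f q → Separated (u ++ block) p q
      separated-by-A p-in q-out = u , block , refl , image∈P , p-in , q-out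

      separated′ : InversionsSeparated (u ++ block)
      separated′ {c} {d} 1≤c c<d side inv =
        subst₂ (Separated (u ++ block)) (sym (f∘π c)) (sym (f∘π d)) (go side (subst₂ _<_ (f∘π d) (f∘π c) inv))
        where
        go : SameSide c d → f (π d) < f (π c) → Separated (u ++ block) (f (π c)) (f (π d))
        go (inj₁ d≤k) inv′ with m≤n⇒m<n∨m≡n d≤k
        ... | inj₂ refl = let (1≤πc , πc≤k) = π-left-range 1≤c c<d in
          separated-by-A (attained 1≤πc πc≤k) (subst (¬_ ∘ Attains k f) (cong f (sym π-k)) (unattained k<b))
        ... | inj₁ d<k  = extend-separation
          (separated (proj₁ (π-left-range 1≤c (<-trans c<d d<k))) (π-left-mono c<d d<k)
                     (inj₁ (proj₂ (π-left-range (≤-trans 1≤c (<⇒≤ c<d)) d<k))) inv′)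
        go (inj₂ (k<c , d≤n)) inv′ with m≤n⇒m<n∨m≡n k<c
        ... | inj₂ refl = separated-by-A (subst (Attains k f ∘ f) (sym π-1+k) (attained 1≤a a≤k))
                                         (unattained (proj₁ (π-right-range c<d)))
        ... | inj₁ k+1<c = extend-separation
          (separated (≤-trans (s≤s z≤n) k<πc) (π-right-mono k+1<c c<d)
                     (inj₂ (k<πc , ≤-trans (proj₂ (π-right-range (<-trans k+1<c c<d))) d≤n)) inv′)
          where k<πc = proj₁ (π-right-range k+1<c)

    admissible : Admissible (u ++ block)
    admissible = record
      { word      = ++⁺ word (block-word 1≤a (proj₂ b-range))
      ; ascending = Ascending-++⁺ (λ x → x) u ascending (Ascending-block f left-ascent right-ascent corner)
      ; image∈P   = subst (_∈ₗ P) (sym image≡B) B∈P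
      ; separated = separated′
      }

  extend : ∀ {u B} → Admissible u → B ∈ₗ P → MonotoneStep (image n k (act u)) B →
           ∃ λ v → prefixesEndingIn k v ≡ [ v ] × Admissible (u ++ v) × image n k (act (u ++ v)) ≡ B
  extend adm B∈P step = block , prefixesEndingIn-block , admissible , image≡B
    where open Extend adm B∈P step

  realise : ∀ u rest → Admissible u → Pk n k u ++ rest ≡ P → Linked MonotoneStep (image n k (act u) ∷ rest) →
            ∃ λ w → Admissible w × Pk n k w ≡ P
  realise u []         adm eq _                = u , adm , trans (sym (++-identityʳ _)) eq
  realise u (B ∷ rest) adm eq (step ∷ linked) with extend adm (subst (B ∈ₗ_) eq (∈-++⁺ʳ (Pk n k u) (here refl))) step
  ... | v , pv , adm′ , image≡B =
    realise (u ++ v) rest adm′ eq′ (subst (λ A → Linked MonotoneStep (A ∷ rest)) (sym image≡B) linked)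
    where
    eq′ : Pk n k (u ++ v) ++ rest ≡ P
    eq′ = begin
      Pk n k (u ++ v) ++ rest                              ≡⟨ cong (_++ rest) (Pk-++ u v pv) ⟩
      (Pk n k u ++ [ image n k (act (u ++ v)) ]) ++ rest   ≡⟨ ++-assoc (Pk n k u) _ rest ⟩
      Pk n k u ++ image n k (act (u ++ v)) ∷ rest          ≡⟨ cong (λ A → Pk n k u ++ A ∷ rest) image≡B ⟩
      Pk n k u ++ B ∷ rest                                 ≡⟨ eq ⟩
      P                                                    ∎
      where open ≡-Reasoning

monotoneWSPath⇒Pk : ∀ {n k} → k ≤ n → ∀ rest → MonotoneWSPath n k (firstK n k ∷ rest) →
                    Σ (List ℕ) λ w → Reduced n w × Pk n k w ≡ firstK n k ∷ rest
monotoneWSPath⇒Pk {n} {k} k≤n rest (_ , ws , linked) =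
  let (w , adm , Pk≡) = realise [] rest start (cong (_∷ rest) start≡firstK)
                          (subst (λ A → Linked MonotoneStep (A ∷ rest)) (sym start≡firstK) linked)
  in w , ascending⇒reduced {n} (Admissible.word adm) (Admissible.ascending adm) , Pk≡
  where
  open Converse k≤n (firstK n k ∷ rest) ws
  start≡firstK = image-id≡firstK n k
  start : Admissible []
  start = record
    { word      = []
    ; ascending = tt
    ; image∈P   = here start≡firstK
    ; separated = λ _ c<d _ d<c → contradiction c<d (<-asym d<c)
    }

proposition2p1 : (n k : ℕ) → k ≤ n →
    ((w : List ℕ) → Reduced n w → MonotoneWSPath n k (Pk n k w))
    × ((rest : List (Subset n)) → MonotoneWSPath n k (firstK n k ∷ rest) →
        Σ (List ℕ) λ w → Reduced n w × (Pk n k w ≡ firstK n k ∷ rest))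
proposition2p1 n k k≤n = (λ w → reduced⇒monotoneWSPath k≤n) , monotoneWSPath⇒Pk k≤n
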